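{- Let $G$ and $H$ be graphs without isolated vertices. Then $$(G\times H)^{[\natural 2]}=(G^{[[2]]}\,\square\, H^{[[2]]} )\uplus (G^{[[2]]}\times H^{[\natural 2]} )\uplus (G^{[\natural 2]}\times H^{[[2]]})\,.$$ In particular, if $G$ and $H$ are triangle-free, then $$(G\times H)^{[\natural 2]}=G^{[\natural 2]}\boxtimes H^{[\natural 2]}\,.$$
   Context: For a graph $G$, $G^{[\natural 2]}$ is the graph on $V(G)$ in which two vertices are adjacent iff their distance in $G$ is exactly $2$. $G^{[[2]]}$ is the graph on $V(G)$ in which two vertices $x,y$ are adjacent iff they are connected in $G$ by a path of length $2$ (i.e. $x\neq y$ and they have a common neighbor). If two graphs have the same vertex set, $\uplus$ denotes the graph on that vertex set whose edge set is the union of the edge sets. All products have vertex set $V(G)\times V(H)$. Direct product $G\times H$: $(g_1,h_1)(g_2,h_2)$ is an edge iff $g_1g_2\in E(G)$ and $h_1h_2\in E(H)$. Cartesian product $G\,\square\,H$: edge iff either $g_1g_2\in E(G)$ and $h_1=h_2$, or $g_1=g_2$ and $h_1h_2\in E(H)$. Strong product $G\boxtimes H$: distinct vertices adjacent iff $g_1g_2\in E(G)$ and $h_1=h_2$, or $g_1=g_2$ and $h_1h_2\in E(H)$, or $g_1g_2\in E(G)$ and $h_1h_2\in E(H)$. Equalities are equalities of graphs on $V(G)\times V(H)$. -}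

module Defs where

open import Data.Nat using (ℕ; zero; suc; _<_)
open import Data.Fin using (Fin)
open import Data.Product using (Σ; ∃; _×_; _,_)
open import Data.Sum using (_⊎_)
open import Data.Empty using (⊥)
open import Relation.Nullary using (¬_; Dec)
open import Relation.Binary.PropositionalEquality using (_≡_)
open import Function.Bundles using (_⇔_)

Rel : Set → Set₁
Rel V = V → V → Set

record Graph (V : Set) : Set₁ where
  field
    Adj    : Rel V
    irrefl : ∀ x → ¬ Adj x x
    sym    : ∀ {x y} → Adj x y → Adj y x
    dec    : ∀ x y → Dec (Adj x y)
open Graph public

Walk : {V : Set} → Rel V → ℕ → V → V → Set
Walk R zero    x y = x ≡ y
Walk R (suc k) x y = ∃ λ z → R x z × Walk R k z y

DistEq : {V : Set} → Rel V → ℕ → Rel V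
DistEq R k x y = Walk R k x y × (∀ j → j < k → ¬ Walk R j x y)

-- G^[♮2] : adjacency = distance exactly 2 in G
Exact2 : {V : Set} → Rel V → Rel V
Exact2 R = DistEq R 2

-- G^[[2]] : x ≠ y and connected by a path of length 2 (common neighbour)
Path2 : {V : Set} → Rel V → Rel V
Path2 R x y = ¬ (x ≡ y) × Walk R 2 x y

_⊎ᴿ_ : {V : Set} → Rel V → Rel V → Rel V
(R ⊎ᴿ S) x y = R x y ⊎ S x y
infixr 4 _⊎ᴿ_

_×ᴿ_ : {V W : Set} → Rel V → Rel W → Rel (V × W)
(R ×ᴿ S) (g₁ , h₁) (g₂ , h₂) = R g₁ g₂ × S h₁ h₂

_□ᴿ_ : {V W : Set} → Rel V → Rel W → Rel (V × W)
(R □ᴿ S) (g₁ , h₁) (g₂ , h₂) = (R g₁ g₂ × h₁ ≡ h₂) ⊎ (g₁ ≡ g₂ × S h₁ h₂)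

_⊠ᴿ_ : {V W : Set} → Rel V → Rel W → Rel (V × W)
(R ⊠ᴿ S) (g₁ , h₁) (g₂ , h₂) =
  ¬ ((g₁ , h₁) ≡ (g₂ , h₂)) ×
  ((R g₁ g₂ × h₁ ≡ h₂) ⊎ (g₁ ≡ g₂ × S h₁ h₂) ⊎ (R g₁ g₂ × S h₁ h₂))

infixr 6 _×ᴿ_ _□ᴿ_ _⊠ᴿ_

_≅ᴿ_ : {V : Set} → Rel V → Rel V → Set
R ≅ᴿ S = ∀ x y → R x y ⇔ S x y
infix 2 _≅ᴿ_

NoIsolated : {V : Set} → Graph V → Set
NoIsolated G = ∀ x → ∃ λ y → Adj G x y

TriangleFree : {V : Set} → Graph V → Set
TriangleFree G = ∀ x y z → Adj G x y → Adj G y z → Adj G x z → ⊥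

-- A 2-walk in G × H is a pair of 2-walks, and a vertex of a graph without
-- isolated vertices has a closed 2-walk. So (g₁,h₁) and (g₂,h₂) are at
-- distance exactly 2 iff they are distinct, joined coordinatewise by 2-walks
-- and not adjacent; splitting on which coordinates agree and on whether g₁g₂
-- is an edge yields the three summands. In a triangle-free graph two vertices
-- with a common neighbour are not adjacent, so G^[[2]] = G^[♮2] and the
-- summands collapse to the strong product.
module Submission where

open import Defs
open import Data.Nat using (ℕ; suc; z≤n; s≤s)
open import Data.Fin using (Fin; _≟_)
open import Data.Product using (_×_; _,_; proj₁; proj₂)
open import Data.Sum using (inj₁; inj₂)
open import Data.Empty using (⊥-elim)
open import Relation.Nullary using (¬_; yes; no)
open import Relation.Binary.Definitions using (DecidableEquality)
open import Relation.Binary.PropositionalEquality using (_≡_; refl; cong)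
open import Function.Bundles using (mk⇔)
open import Function.Construct.Composition using (_⇔-∘_)

≅ᴿ-trans : {V : Set} {R S T : Rel V} → R ≅ᴿ S → S ≅ᴿ T → R ≅ᴿ T
≅ᴿ-trans R≅S S≅T x y = S≅T x y ⇔-∘ R≅S x y

module _ {V : Set} {R : Rel V} where

  Exact2-intro : ∀ {x y} → ¬ x ≡ y → Walk R 2 x y → ¬ R x y → Exact2 R x y
  Exact2-intro x≢y w ¬r = w , λ
    { 0 _ x≡y → x≢y x≡y
    ; 1 _ (_ , r , refl) → ¬r r
    ; (suc (suc _)) (s≤s (s≤s ())) _
    }

  Exact2⇒≢ : ∀ {x y} → Exact2 R x y → ¬ x ≡ y
  Exact2⇒≢ (_ , shorter) = shorter 0 (s≤s z≤n)

  Exact2⇒¬adjacent : ∀ {x y} → Exact2 R x y → ¬ R x y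
  Exact2⇒¬adjacent (_ , shorter) r = shorter 1 (s≤s (s≤s z≤n)) (_ , r , refl)

  Exact2⇒Path2 : ∀ {x y} → Exact2 R x y → Path2 R x y
  Exact2⇒Path2 e = Exact2⇒≢ e , proj₁ e

module _ {V W : Set} {g₁ g₂ : V} {h₁ h₂ : W} where

  ≢-proj₁ : ¬ g₁ ≡ g₂ → ¬ (g₁ , h₁) ≡ (g₂ , h₂)
  ≢-proj₁ g₁≢g₂ eq = g₁≢g₂ (cong proj₁ eq)

  ≢-proj₂ : ¬ h₁ ≡ h₂ → ¬ (g₁ , h₁) ≡ (g₂ , h₂)
  ≢-proj₂ h₁≢h₂ eq = h₁≢h₂ (cong proj₂ eq)

module _ {V W : Set} {R : Rel V} {S : Rel W} where

  Walk2-×⁻ : ∀ {g₁ h₁ g₂ h₂} → Walk (R ×ᴿ S) 2 (g₁ , h₁) (g₂ , h₂) →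
             Walk R 2 g₁ g₂ × Walk S 2 h₁ h₂
  Walk2-×⁻ ((g , h) , (r₁ , s₁) , _ , (r₂ , s₂) , refl) =
    (g , r₁ , _ , r₂ , refl) , (h , s₁ , _ , s₂ , refl)

  Walk2-×⁺ : ∀ {g₁ h₁ g₂ h₂} → Walk R 2 g₁ g₂ → Walk S 2 h₁ h₂ →
             Walk (R ×ᴿ S) 2 (g₁ , h₁) (g₂ , h₂)
  Walk2-×⁺ (g , r₁ , _ , r₂ , refl) (h , s₁ , _ , s₂ , refl) =
    (g , h) , (r₁ , s₁) , _ , (r₂ , s₂) , refl

NoIsolated⇒closedWalk2 : {V : Set} (G : Graph V) → NoIsolated G →
                         ∀ x → Walk (Adj G) 2 x x
NoIsolated⇒closedWalk2 G noIsolated x with noIsolated x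
... | y , xy = y , xy , x , Graph.sym G xy , refl

TriangleFree⇒Path2⇒Exact2 : {V : Set} (G : Graph V) → TriangleFree G →
                            ∀ {x y} → Path2 (Adj G) x y → Exact2 (Adj G) x y
TriangleFree⇒Path2⇒Exact2 G triangleFree (x≢y , w@(z , xz , _ , zy , refl)) =
  Exact2-intro x≢y w (triangleFree _ z _ xz zy)

Exact2-×-decomposition : {V W : Set} → Rel V → Rel W → Rel (V × W)
Exact2-×-decomposition R S =
  (Path2 R □ᴿ Path2 S) ⊎ᴿ (Path2 R ×ᴿ Exact2 S) ⊎ᴿ (Exact2 R ×ᴿ Path2 S)

module _ {V W : Set} (_≟ⱽ_ : DecidableEquality V) (_≟ᵂ_ : DecidableEquality W)
         (G : Graph V) (H : Graph W) where

  Exact2-×⇒decomposition : ∀ x y → Exact2 (Adj G ×ᴿ Adj H) x y →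
                           Exact2-×-decomposition (Adj G) (Adj H) x y
  Exact2-×⇒decomposition (g₁ , h₁) (g₂ , h₂) e
    with Walk2-×⁻ {R = Adj G} {S = Adj H} (proj₁ e) | g₁ ≟ⱽ g₂ | h₁ ≟ᵂ h₂
  ... | _  , _  | yes refl | yes refl = ⊥-elim (Exact2⇒≢ e refl)
  ... | _  , wh | yes refl | no h₁≢h₂ = inj₁ (inj₂ (refl , h₁≢h₂ , wh))
  ... | wg , _  | no g₁≢g₂ | yes refl = inj₁ (inj₁ ((g₁≢g₂ , wg) , refl))
  ... | wg , wh | no g₁≢g₂ | no h₁≢h₂ with Graph.dec G g₁ g₂
  ...   | yes g₁g₂ = inj₂ (inj₁ ((g₁≢g₂ , wg) ,
                       Exact2-intro h₁≢h₂ wh (λ h₁h₂ → Exact2⇒¬adjacent e (g₁g₂ , h₁h₂))))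
  ...   | no ¬g₁g₂ = inj₂ (inj₂ (Exact2-intro g₁≢g₂ wg ¬g₁g₂ , (h₁≢h₂ , wh)))

  module _ (noIsolatedG : NoIsolated G) (noIsolatedH : NoIsolated H) where

    decomposition⇒Exact2-× : ∀ x y → Exact2-×-decomposition (Adj G) (Adj H) x y →
                             Exact2 (Adj G ×ᴿ Adj H) x y
    decomposition⇒Exact2-× (g₁ , h₁) _ (inj₁ (inj₁ ((g₁≢g₂ , wg) , refl))) =
      Exact2-intro (≢-proj₁ g₁≢g₂)
        (Walk2-×⁺ wg (NoIsolated⇒closedWalk2 H noIsolatedH h₁))
        (λ (_ , h₁h₁) → Graph.irrefl H h₁ h₁h₁)
    decomposition⇒Exact2-× (g₁ , _) _ (inj₁ (inj₂ (refl , (h₁≢h₂ , wh)))) =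
      Exact2-intro (≢-proj₂ h₁≢h₂)
        (Walk2-×⁺ (NoIsolated⇒closedWalk2 G noIsolatedG g₁) wh)
        (λ (g₁g₁ , _) → Graph.irrefl G g₁ g₁g₁)
    decomposition⇒Exact2-× _ _ (inj₂ (inj₁ ((g₁≢g₂ , wg) , eh))) =
      Exact2-intro (≢-proj₁ g₁≢g₂) (Walk2-×⁺ wg (proj₁ eh))
        (λ (_ , h₁h₂) → Exact2⇒¬adjacent eh h₁h₂)
    decomposition⇒Exact2-× _ _ (inj₂ (inj₂ (eg , (h₁≢h₂ , wh)))) =
      Exact2-intro (≢-proj₂ h₁≢h₂) (Walk2-×⁺ (proj₁ eg) wh)
        (λ (g₁g₂ , _) → Exact2⇒¬adjacent eg g₁g₂)

    Exact2-×≅decomposition :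
      Exact2 (Adj G ×ᴿ Adj H) ≅ᴿ Exact2-×-decomposition (Adj G) (Adj H)
    Exact2-×≅decomposition x y =
      mk⇔ (Exact2-×⇒decomposition x y) (decomposition⇒Exact2-× x y)

module _ {V W : Set} (G : Graph V) (H : Graph W)
         (triangleFreeG : TriangleFree G) (triangleFreeH : TriangleFree H) where

  private
    Path2⇒Exact2ᴳ : ∀ {x y} → Path2 (Adj G) x y → Exact2 (Adj G) x y
    Path2⇒Exact2ᴳ = TriangleFree⇒Path2⇒Exact2 G triangleFreeG

    Path2⇒Exact2ᴴ : ∀ {x y} → Path2 (Adj H) x y → Exact2 (Adj H) x y
    Path2⇒Exact2ᴴ = TriangleFree⇒Path2⇒Exact2 H triangleFreeH

  decomposition≅⊠ : Exact2-×-decomposition (Adj G) (Adj H)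
                    ≅ᴿ (Exact2 (Adj G) ⊠ᴿ Exact2 (Adj H))
  decomposition≅⊠ (g₁ , h₁) (g₂ , h₂) = mk⇔ to from
    where
    to : Exact2-×-decomposition (Adj G) (Adj H) (g₁ , h₁) (g₂ , h₂) →
         (Exact2 (Adj G) ⊠ᴿ Exact2 (Adj H)) (g₁ , h₁) (g₂ , h₂)
    to (inj₁ (inj₁ (pg , refl))) = ≢-proj₁ (proj₁ pg) , inj₁ (Path2⇒Exact2ᴳ pg , refl)
    to (inj₁ (inj₂ (refl , ph))) = ≢-proj₂ (proj₁ ph) , inj₂ (inj₁ (refl , Path2⇒Exact2ᴴ ph))
    to (inj₂ (inj₁ (pg , eh)))   = ≢-proj₁ (proj₁ pg) , inj₂ (inj₂ (Path2⇒Exact2ᴳ pg , eh))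
    to (inj₂ (inj₂ (eg , ph)))   = ≢-proj₂ (proj₁ ph) , inj₂ (inj₂ (eg , Path2⇒Exact2ᴴ ph))

    from : (Exact2 (Adj G) ⊠ᴿ Exact2 (Adj H)) (g₁ , h₁) (g₂ , h₂) →
           Exact2-×-decomposition (Adj G) (Adj H) (g₁ , h₁) (g₂ , h₂)
    from (_ , inj₁ (eg , refl))        = inj₁ (inj₁ (Exact2⇒Path2 eg , refl))
    from (_ , inj₂ (inj₁ (refl , eh))) = inj₁ (inj₂ (refl , Exact2⇒Path2 eh))
    from (_ , inj₂ (inj₂ (eg , eh)))   = inj₂ (inj₂ (eg , Exact2⇒Path2 eh))

theorem2p4 : (n m : ℕ) (G : Graph (Fin n)) (H : Graph (Fin m)) →
    NoIsolated G → NoIsolated H →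
    (Exact2 (Adj G ×ᴿ Adj H)
      ≅ᴿ (Path2 (Adj G) □ᴿ Path2 (Adj H))
         ⊎ᴿ (Path2 (Adj G) ×ᴿ Exact2 (Adj H))
         ⊎ᴿ (Exact2 (Adj G) ×ᴿ Path2 (Adj H)))
    × (TriangleFree G → TriangleFree H →
       Exact2 (Adj G ×ᴿ Adj H) ≅ᴿ (Exact2 (Adj G) ⊠ᴿ Exact2 (Adj H)))
theorem2p4 n m G H noIsolatedG noIsolatedH =
  G×H-decomposition ,
  λ triangleFreeG triangleFreeH →
    ≅ᴿ-trans G×H-decomposition (decomposition≅⊠ G H triangleFreeG triangleFreeH)
  where
  G×H-decomposition : Exact2 (Adj G ×ᴿ Adj H) ≅ᴿ Exact2-×-decomposition (Adj G) (Adj H)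
  G×H-decomposition = Exact2-×≅decomposition _≟_ _≟_ G H noIsolatedG noIsolatedH
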